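{- $\vdash x\oplus(y\oplus z)=(x\oplus y)\oplus z$.
   Context: PRA (Primitive Recursive Arithmetic) is the quantifier-free formal system whose symbols are variables, PR function symbols, $=$, $\neg$, $\vee$; formulas are built from equations by $\neg,\vee$, with $\wedge,\to,\leftrightarrow$ the usual abbreviations. A function symbol is defined by primitive recursion by $f(\vec x,0)=a$, $f(\vec x,Sy)=b_z(f(\vec x,y))$; PR function symbols are those obtainable from $0$ and $S$ by finitely many such definitions. Axioms: defining equations; $\neg\,Sx=0$; $Sx=Sy\to x=y$; $x=x$; $x=y\to y=x$; $x=y\wedge A_x(x)\to A_x(y)$; propositional axioms $A\vee A\to A$, $A\to A\vee B$, $A\vee B\to B\vee A$, $(B\to C)\to(A\vee B\to A\vee C)$. Rules: instance, modus ponens, induction. $\vdash$ denotes provability in PRA. Symbols: $x+0=x$, $x+Sy=S(x+y)$; $P0=0$, $PSx=x$; $x-0=x$, $x-Sy=P(x-y)$; $C(0,y,z)=y$, $C(Sx,y,z)=z$; $\mathrm{Eq}(x,y)=(x-y)+(y-x)$; $x\mathrel{\dot=}y=C(\mathrm{Eq}(x,y),0,S0)$, $\dot\neg x=C(x,S0,0)$, $x\mathbin{\dot\vee}y=C(x,0,C(y,0,S0))$, $\chi A$ replaces $=,\neg,\vee$ by these. $x\cdot0=0$, $x\cdot Sy=x+x\cdot y$; $x\uparrow0=S0$, $x\uparrow Sy=x\cdot(x\uparrow y)$; $1=S0$, $2=SS0$; $x\le y$ abbreviates $x-y=0$, $x<y$ abbreviates $x\le y\wedge x\ne y$. For a formula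 $B$ in variable $q$ with other variables $\vec y$: $\mu_B(\vec y,0)=C(\chi[B_q(0)],0,S0)$, $\mu_B(\vec y,Sq)=C(\chi[\mu_B(\vec y,q)\le q],\mu_B(\vec y,q),C(\chi[B_q(Sq)],Sq,SSq))$; $\exists q{\le}b\,B$ abbreviates $B_q(\mu_B(\vec y,b))$. "$q$ is a power of two" abbreviates $\exists x{\le}q[2\uparrow x=q]$. $Qx$ abbreviates $\mu_B(x,Sx)$ where $B$ is "$q$ is a power of two $\wedge\ q\le Sx\wedge Sx<2\cdot q$"; it satisfies $\vdash Qx=q\leftrightarrow B$. $Rx=Sx-Qx$. $x\oplus y=P(Sx\cdot Qy+Ry)$ (string concatenation, identifying $x$ with the binary string following the leading 1 of $Sx$). -}

module Defs where

open import Data.Nat using (ℕ; zero; suc)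
open import Data.Fin using (Fin; zero; suc)
open import Data.Vec using (Vec; []; _∷_; _∷ʳ_; lookup)

-- A function symbol of arity
-- suc k is introduced by  rec a b  with
--   f(x⃗,0)  = a                (a : Tm k, variables x⃗ = x₀..x_{k-1})
--   f(x⃗,Sy) = b_z(f(x⃗,y))    (b : Tm (2+k); var 0 = z, var 1 = y,
--                               var (2+i) = xᵢ)
-- PR function symbols are exactly the Fn's: obtained from 0 and S by
-- finitely many such definitions.

mutual
  data Tm (n : ℕ) : Set where
    var : Fin n → Tm n
    Z   : Tm n
    S   : Tm n → Tm n
    app : {k : ℕ} → Fn k → Vec (Tm n) k → Tm n

  data Fn : ℕ → Set where
    rec : {k : ℕ} → Tm k → Tm (suc (suc k)) → Fn (suc k)

data Fm (n : ℕ) : Set where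
  _≐_ : Tm n → Tm n → Fm n
  ¬'_ : Fm n → Fm n
  _∨'_ : Fm n → Fm n → Fm n

infix 5 _≐_
infixr 4 _∨'_
infixr 3 _∧'_
infixr 2 _⇒_

_∧'_ : {n : ℕ} → Fm n → Fm n → Fm n
A ∧' B = ¬' (¬' A ∨' ¬' B)

_⇒_ : {n : ℕ} → Fm n → Fm n → Fm n
A ⇒ B = ¬' A ∨' B

mutual
  substT : {n m : ℕ} → (Fin n → Tm m) → Tm n → Tm m
  substT σ (var i) = σ i
  substT σ Z = Z
  substT σ (S t) = S (substT σ t)
  substT σ (app f ts) = app f (substV σ ts)

  substV : {n m k : ℕ} → (Fin n → Tm m) → Vec (Tm n) k → Vec (Tm m) k
  substV σ [] = []
  substV σ (t ∷ ts) = substT σ t ∷ substV σ ts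

substF : {n m : ℕ} → (Fin n → Tm m) → Fm n → Fm m
substF σ (s ≐ t) = substT σ s ≐ substT σ t
substF σ (¬' A) = ¬' substF σ A
substF σ (A ∨' B) = substF σ A ∨' substF σ B

inst0 : {n : ℕ} → Tm n → Fin (suc n) → Tm n
inst0 t zero = t
inst0 t (suc i) = var i

repl0 : {n : ℕ} → Tm (suc n) → Fin (suc n) → Tm (suc n)
repl0 t zero = t
repl0 t (suc i) = var (suc i)

stepσ : {n k : ℕ} → Tm n → Tm n → Vec (Tm n) k → Fin (suc (suc k)) → Tm n
stepσ zval y xs zero = zval
stepσ zval y xs (suc zero) = y
stepσ zval y xs (suc (suc i)) = lookup xs i

-- Provability in PRA:  ⊢ A  (A a formula in context n).
-- Axiom schemata are stated for arbitrary terms; because of the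
-- instance rule this yields the same theorems as the variable forms.

data ⊢_ : {n : ℕ} → Fm n → Set where
  defZ  : {n k : ℕ} (a : Tm k) (b : Tm (suc (suc k))) (xs : Vec (Tm n) k) →
          ⊢ (app (rec a b) (xs ∷ʳ Z) ≐ substT (lookup xs) a)
  defS  : {n k : ℕ} (a : Tm k) (b : Tm (suc (suc k))) (xs : Vec (Tm n) k) (y : Tm n) →
          ⊢ (app (rec a b) (xs ∷ʳ S y) ≐ substT (stepσ (app (rec a b) (xs ∷ʳ y)) y xs) b)
  ax-S0 : {n : ℕ} (x : Tm n) → ⊢ (¬' (S x ≐ Z))
  ax-SS : {n : ℕ} (x y : Tm n) → ⊢ (S x ≐ S y ⇒ x ≐ y)
  ax-refl : {n : ℕ} (x : Tm n) → ⊢ (x ≐ x)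
  ax-sym  : {n : ℕ} (x y : Tm n) → ⊢ (x ≐ y ⇒ y ≐ x)
  ax-eq   : {n : ℕ} (A : Fm (suc n)) (x y : Tm n) →
            ⊢ ((x ≐ y) ∧' substF (inst0 x) A ⇒ substF (inst0 y) A)
  ax-contr : {n : ℕ} (A : Fm n) → ⊢ (A ∨' A ⇒ A)
  ax-weak  : {n : ℕ} (A B : Fm n) → ⊢ (A ⇒ A ∨' B)
  ax-perm  : {n : ℕ} (A B : Fm n) → ⊢ (A ∨' B ⇒ B ∨' A)
  ax-assoc : {n : ℕ} (A B C : Fm n) → ⊢ ((B ⇒ C) ⇒ (A ∨' B ⇒ A ∨' C))
  instance-rule : {n m : ℕ} {A : Fm n} (σ : Fin n → Tm m) → ⊢ A → ⊢ substF σ A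
  mp   : {n : ℕ} {A B : Fm n} → ⊢ A → ⊢ (A ⇒ B) → ⊢ B
  ind  : {n : ℕ} {A : Fm (suc n)} →
         ⊢ substF (inst0 Z) A →
         ⊢ (A ⇒ substF (repl0 (S (var zero))) A) →
         ⊢ A

infix 1 ⊢_

v0 : {n : ℕ} → Tm (suc n)
v0 = var zero
v1 : {n : ℕ} → Tm (suc (suc n))
v1 = var (suc zero)
v2 : {n : ℕ} → Tm (suc (suc (suc n)))
v2 = var (suc (suc zero))

plusF : Fn 2
plusF = rec v0 (S v0)

predF : Fn 1
predF = rec Z v1

minusF : Fn 2
minusF = rec v0 (app predF (v0 ∷ []))

-- C(0,y,z) = y , C(Sx,y,z) = z.  Stored with the recursion argument
-- last: condF'(y,z,x) = C(x,y,z); a = var 0 (= y), b = var 3 (= z).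
condF' : Fn 3
condF' = rec v0 (var (suc (suc (suc zero))))

timesF : Fn 2
timesF = rec Z (app plusF (v2 ∷ v0 ∷ []))

powF : Fn 2
powF = rec (S Z) (app timesF (v2 ∷ v0 ∷ []))

module _ {n : ℕ} where
  _+'_ _-'_ _·'_ _↑'_ : Tm n → Tm n → Tm n
  s +' t = app plusF (s ∷ t ∷ [])
  s -' t = app minusF (s ∷ t ∷ [])
  s ·' t = app timesF (s ∷ t ∷ [])
  s ↑' t = app powF (s ∷ t ∷ [])

  P' : Tm n → Tm n
  P' t = app predF (t ∷ [])

  C' : Tm n → Tm n → Tm n → Tm n
  C' x y z = app condF' (y ∷ z ∷ x ∷ [])

  Eq' : Tm n → Tm n → Tm n
  Eq' x y = (x -' y) +' (y -' x)

  one two : Tm n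
  one = S Z
  two = S (S Z)

  χ : Fm n → Tm n
  χ (s ≐ t) = C' (Eq' s t) Z (S Z)
  χ (¬' A) = C' (χ A) (S Z) Z
  χ (A ∨' B) = C' (χ A) Z (C' (χ B) Z (S Z))

  _≤'_ _<'_ : Tm n → Tm n → Fm n
  s ≤' t = (s -' t) ≐ Z
  s <' t = (s ≤' t) ∧' ¬' (s ≐ t)

-- μ_B for B : Fm (suc k), var 0 = q, var (suc i) = yᵢ.
μF : {k : ℕ} → Fm (suc k) → Fn (suc k)
μF {k} B = rec (C' (χ (substF (inst0 Z) B)) Z (S Z))
               (C' (χ (v0 ≤' v1)) v0
                   (C' (χ (substF σ B)) (S v1) (S (S v1))))
  where
  -- B_q(Sq) in the step context (var 0 = z, var 1 = q, var (2+i) = yᵢ)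
  σ : Fin (suc k) → Tm (suc (suc k))
  σ zero = S v1
  σ (suc i) = var (suc (suc i))

-- "q is a power of two" := ∃x≤q [2↑x = q]
-- B' : var 0 = x (bounded), var 1 = q.
pow2B : Fm 2
pow2B = two ↑' v0 ≐ v1

isPow2 : {n : ℕ} → Tm n → Fm n
isPow2 t = substF σ pow2B where
  σ : Fin 2 → Tm _
  σ zero = app (μF pow2B) (t ∷ t ∷ [])
  σ (suc zero) = t

-- B for Q : var 0 = q, var 1 = x
QB : Fm 2
QB = isPow2 v0 ∧' (v0 ≤' S v1) ∧' (S v1 <' (two ·' v0))

Q' : {n : ℕ} → Tm n → Tm n
Q' x = app (μF QB) (x ∷ S x ∷ [])

R' : {n : ℕ} → Tm n → Tm n
R' x = S x -' Q' x

_⊕_ : {n : ℕ} → Tm n → Tm n → Tm n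
x ⊕ y = P' ((S x ·' Q' y) +' R' y)

infixl 7 _⊕_

-- Read S x in binary: Q x is the largest power of two not exceeding S x and
-- R x = S x ∸ Q x is the string after the leading 1, so that
-- S (x ⊕ y) = S x · Q y + R y.  Since Q z is the only power of two q with
-- q ≤ S z < 2q, this gives Q (x ⊕ y) = Q x · Q y and then
-- R (x ⊕ y) = R x · Q y + R y; both sides of the associativity law thus have
-- successor S x · Q y · Q z + R y · Q z + R z.

module Submission where

open import Defs
open import Data.Nat using (ℕ; zero; suc; _≡ᵇ_)
open import Data.Nat.Properties using (≡ᵇ⇒≡)
open import Data.Fin using (Fin; zero; suc)
open import Data.Vec using (Vec; []; _∷_; lookup)
open import Data.List using (List; []; _∷_; _++_)
open import Data.Bool using (Bool; false; _∧_; _∨_; T)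
open import Data.Bool.Properties using (T-∧; T-∨)
open import Data.Unit using (tt)
open import Data.Sum using (inj₁; inj₂)
open import Data.Product using (_,_)
open import Function.Bundles using (module Equivalence)
open import Relation.Binary.PropositionalEquality using (_≡_; refl; cong; cong₂; subst; sym; trans)

open Equivalence using (to)

private variable
  n m k j : ℕ
  A B C H : Fm n
  a b c d : Tm n

-- Propositional calculus

⇒-trans : ⊢ A ⇒ B → ⊢ B ⇒ C → ⊢ A ⇒ C
⇒-trans {A = A} {B} {C} p q = mp p (mp q (ax-assoc (¬' A) B C))

⇒-refl : ⊢ A ⇒ A
⇒-refl {A = A} = ⇒-trans (ax-weak A A) (ax-contr A)

∨-injˡ : ⊢ A ⇒ A ∨' B
∨-injˡ {A = A} {B} = ax-weak A B

∨-injʳ : ⊢ B ⇒ A ∨' B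
∨-injʳ {B = B} {A} = ⇒-trans (ax-weak B A) (ax-perm B A)

∨-monoʳ : ⊢ B ⇒ C → ⊢ A ∨' B ⇒ A ∨' C
∨-monoʳ {B = B} {C} {A} p = mp p (ax-assoc A B C)

∨-monoˡ : ⊢ A ⇒ C → ⊢ A ∨' B ⇒ C ∨' B
∨-monoˡ {A = A} {C} {B} p = ⇒-trans (ax-perm A B) (⇒-trans (∨-monoʳ p) (ax-perm B C))

∨-elim : ⊢ A ⇒ C → ⊢ B ⇒ C → ⊢ A ∨' B ⇒ C
∨-elim {C = C} p q = ⇒-trans (∨-monoˡ p) (⇒-trans (∨-monoʳ q) (ax-contr C))

¬¬-intro : ⊢ A ⇒ ¬' ¬' A
¬¬-intro {A = A} = mp (⇒-refl {A = ¬' A}) (ax-perm (¬' ¬' A) (¬' A))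

∨-exchange : ⊢ A ∨' (B ∨' C) ⇒ B ∨' (A ∨' C)
∨-exchange = ∨-elim (⇒-trans ∨-injˡ ∨-injʳ) (∨-monoʳ ∨-injʳ)

∨-assoc : ⊢ A ∨' (B ∨' C) ⇒ (A ∨' B) ∨' C
∨-assoc = ∨-elim (⇒-trans ∨-injˡ ∨-injˡ) (∨-elim (⇒-trans ∨-injʳ ∨-injˡ) ∨-injʳ)

⊤' ⊥' : Fm n
⊤' = Z ≐ Z
⊥' = ¬' ⊤'

-- Tautologies are proved by reflection: a one-sided sequent search on
-- propositional formulas over numbered atoms, sound for every
-- interpretation of the atoms as formulas of PRA.

data Prop : Set where
  atom : ℕ → Prop
  ¬ᵖ_  : Prop → Prop
  _∨ᵖ_ : Prop → Prop → Prop

infix  6 ¬ᵖ_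
infixr 4 _∨ᵖ_
infixr 3 _∧ᵖ_
infixr 2 _⇒ᵖ_
infix  2 _⇔ᵖ_

_∧ᵖ_ _⇒ᵖ_ _⇔ᵖ_ : Prop → Prop → Prop
p ∧ᵖ q = ¬ᵖ (¬ᵖ p ∨ᵖ ¬ᵖ q)
p ⇒ᵖ q = ¬ᵖ p ∨ᵖ q
p ⇔ᵖ q = (p ⇒ᵖ q) ∧ᵖ (q ⇒ᵖ p)

_==_ : Prop → Prop → Bool
atom i   == atom j   = i ≡ᵇ j
(¬ᵖ p)   == (¬ᵖ q)   = p == q
(p ∨ᵖ q) == (r ∨ᵖ s) = (p == r) ∧ (q == s)
_        == _        = false

==⇒≡ : ∀ p q → T (p == q) → p ≡ q
==⇒≡ (atom i) (atom j) eq = cong atom (≡ᵇ⇒≡ i j eq)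
==⇒≡ (¬ᵖ p) (¬ᵖ q) eq = cong ¬ᵖ_ (==⇒≡ p q eq)
==⇒≡ (p ∨ᵖ q) (r ∨ᵖ s) eq with to T-∧ eq
... | eq₁ , eq₂ = cong₂ _∨ᵖ_ (==⇒≡ p r eq₁) (==⇒≡ q s eq₂)

_∈ᵇ_ : Prop → List Prop → Bool
p ∈ᵇ []      = false
p ∈ᵇ (q ∷ l) = (p == q) ∨ (p ∈ᵇ l)

complementary : List Prop → List Prop → Bool
complementary []             L = false
complementary (atom i ∷ ls)  L = ((atom i ∈ᵇ L) ∧ ((¬ᵖ atom i) ∈ᵇ L)) ∨ complementary ls L
complementary (_ ∷ ls)       L = complementary ls L

-- provable fuel Γ L: the disjunction of Γ and of the literals L is a
-- tautology, found by decomposing Γ within the given fuel.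
provable : ℕ → List Prop → List Prop → Bool
provable zero    _                    _ = false
provable (suc k) []                   L = complementary L L
provable (suc k) (atom i ∷ Γ)         L = provable k Γ (atom i ∷ L)
provable (suc k) (¬ᵖ atom i ∷ Γ)      L = provable k Γ (¬ᵖ atom i ∷ L)
provable (suc k) (¬ᵖ ¬ᵖ p ∷ Γ)        L = provable k (p ∷ Γ) L
provable (suc k) (¬ᵖ (p ∨ᵖ q) ∷ Γ)    L = provable k (¬ᵖ p ∷ Γ) L ∧ provable k (¬ᵖ q ∷ Γ) L
provable (suc k) ((p ∨ᵖ q) ∷ Γ)       L = provable k (p ∷ q ∷ Γ) L

module Interpretation (ρ : ℕ → Fm n) where

  ⟦_⟧ : Prop → Fm n
  ⟦ atom i ⟧ = ρ i
  ⟦ ¬ᵖ p ⟧   = ¬' ⟦ p ⟧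
  ⟦ p ∨ᵖ q ⟧ = ⟦ p ⟧ ∨' ⟦ q ⟧

  ⋁ : List Prop → Fm n
  ⋁ []      = ⊥'
  ⋁ (p ∷ l) = ⟦ p ⟧ ∨' ⋁ l

  ∈ᵇ⇒⋁ : ∀ p L → T (p ∈ᵇ L) → ⊢ ⟦ p ⟧ ⇒ ⋁ L
  ∈ᵇ⇒⋁ p (q ∷ L) p∈L with to T-∨ p∈L
  ... | inj₁ p=q rewrite ==⇒≡ p q p=q = ∨-injˡ
  ... | inj₂ p∈L′ = ⇒-trans (∈ᵇ⇒⋁ p L p∈L′) ∨-injʳ

  complementary-sound : ∀ ls L → T (complementary ls L) → ⊢ ⋁ L
  complementary-sound (atom i ∷ ls) L c with to T-∨ c
  ... | inj₂ c′ = complementary-sound ls L c′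
  ... | inj₁ both with to T-∧ both
  ...   | i∈L , ¬i∈L = mp ⇒-refl (∨-elim (∈ᵇ⇒⋁ (¬ᵖ atom i) L ¬i∈L) (∈ᵇ⇒⋁ (atom i) L i∈L))
  complementary-sound ((¬ᵖ _) ∷ ls) L c = complementary-sound ls L c
  complementary-sound ((_ ∨ᵖ _) ∷ ls) L c = complementary-sound ls L c

  ⋁-move : ∀ Γ p L → ⊢ ⋁ (Γ ++ p ∷ L) ⇒ ⋁ (p ∷ Γ ++ L)
  ⋁-move []      p L = ⇒-refl
  ⋁-move (q ∷ Γ) p L = ⇒-trans (∨-monoʳ (⋁-move Γ p L)) ∨-exchange

  provable-sound : ∀ k Γ L → T (provable k Γ L) → ⊢ ⋁ (Γ ++ L)
  provable-sound (suc k) [] L h = complementary-sound L L h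
  provable-sound (suc k) (atom i ∷ Γ) L h =
    mp (provable-sound k Γ (atom i ∷ L) h) (⋁-move Γ (atom i) L)
  provable-sound (suc k) (¬ᵖ atom i ∷ Γ) L h =
    mp (provable-sound k Γ (¬ᵖ atom i ∷ L) h) (⋁-move Γ (¬ᵖ atom i) L)
  provable-sound (suc k) (¬ᵖ ¬ᵖ p ∷ Γ) L h = mp (provable-sound k (p ∷ Γ) L h) (∨-monoˡ ¬¬-intro)
  provable-sound (suc k) (¬ᵖ (p ∨ᵖ q) ∷ Γ) L h with to (T-∧ {provable k (¬ᵖ p ∷ Γ) L}) h
  ... | h₁ , h₂ = ∨-elim (provable-sound k (¬ᵖ p ∷ Γ) L h₁) (provable-sound k (¬ᵖ q ∷ Γ) L h₂)
  provable-sound (suc k) ((p ∨ᵖ q) ∷ Γ) L h = mp (provable-sound k (p ∷ q ∷ Γ) L h) ∨-assoc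

  tautology : ∀ p → T (provable 200 (p ∷ []) []) → ⊢ ⟦ p ⟧
  tautology p h = mp (provable-sound 200 (p ∷ []) [] h) (∨-elim ⇒-refl (mp (mp (ax-refl Z) ¬¬-intro) ∨-injˡ))

at : List (Fm n) → ℕ → Fm n
at []      _       = ⊥'
at (A ∷ l) zero    = A
at (A ∷ l) (suc i) = at l i

-- The side condition is closed, so  tt  proves it by running the checker.
tautology : (l : List (Fm n)) (p : Prop) → T (provable 200 (p ∷ []) []) → ⊢ Interpretation.⟦_⟧ (at l) p
tautology l = Interpretation.tautology (at l)

p₀ p₁ p₂ p₃ p₄ : Prop
p₀ = atom 0
p₁ = atom 1
p₂ = atom 2
p₃ = atom 3
p₄ = atom 4

-- Reasoning under a hypothesis

infix 1 _⊩_
_⊩_ : Fm n → Fm n → Set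
H ⊩ A = ⊢ H ⇒ A

infix 2 _⇔'_
_⇔'_ : Fm n → Fm n → Fm n
A ⇔' B = (A ⇒ B) ∧' (B ⇒ A)

lift : ⊢ A → H ⊩ A
lift {A = A} {H = H} p = mp p (tautology (A ∷ H ∷ []) (p₀ ⇒ᵖ p₁ ⇒ᵖ p₀) tt)

discharge : ⊤' ⊩ A → ⊢ A
discharge p = mp (ax-refl Z) p

⊩-mp : H ⊩ A → H ⊩ (A ⇒ B) → H ⊩ B
⊩-mp {H = H} {A} {B} p q =
  mp q (mp p (tautology (H ∷ A ∷ B ∷ []) ((p₀ ⇒ᵖ p₁) ⇒ᵖ (p₀ ⇒ᵖ p₁ ⇒ᵖ p₂) ⇒ᵖ (p₀ ⇒ᵖ p₂)) tt))

⊩-map : ⊢ A ⇒ B → H ⊩ A → H ⊩ B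
⊩-map p q = ⇒-trans q p

⇒-intro : (H ∧' A) ⊩ B → H ⊩ (A ⇒ B)
⇒-intro {H = H} {A} {B} p = mp p (tautology (H ∷ A ∷ B ∷ []) ((p₀ ∧ᵖ p₁ ⇒ᵖ p₂) ⇒ᵖ (p₀ ⇒ᵖ p₁ ⇒ᵖ p₂)) tt)

hypothesis : H ⊩ H
hypothesis = ⇒-refl

assumption : (H ∧' A) ⊩ A
assumption {H = H} {A} = tautology (H ∷ A ∷ []) (p₀ ∧ᵖ p₁ ⇒ᵖ p₁) tt

weaken : H ⊩ B → (H ∧' A) ⊩ B
weaken {H = H} {A = A} p = ⇒-trans (tautology (H ∷ A ∷ []) (p₀ ∧ᵖ p₁ ⇒ᵖ p₀) tt) p

∧-intro : H ⊩ A → H ⊩ B → H ⊩ A ∧' B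
∧-intro {H = H} {A} {B} p q =
  mp q (mp p (tautology (H ∷ A ∷ B ∷ []) ((p₀ ⇒ᵖ p₁) ⇒ᵖ (p₀ ⇒ᵖ p₂) ⇒ᵖ (p₀ ⇒ᵖ p₁ ∧ᵖ p₂)) tt))

∧-elimˡ : H ⊩ A ∧' B → H ⊩ A
∧-elimˡ {A = A} {B} = ⊩-map (tautology (A ∷ B ∷ []) (p₀ ∧ᵖ p₁ ⇒ᵖ p₀) tt)

∧-elimʳ : H ⊩ A ∧' B → H ⊩ B
∧-elimʳ {A = A} {B} = ⊩-map (tautology (A ∷ B ∷ []) (p₀ ∧ᵖ p₁ ⇒ᵖ p₁) tt)

∨-introˡ : H ⊩ A → H ⊩ A ∨' B
∨-introˡ = ⊩-map ∨-injˡ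

∨-introʳ : H ⊩ B → H ⊩ A ∨' B
∨-introʳ = ⊩-map ∨-injʳ

∨-cases : H ⊩ A ∨' B → (H ∧' A) ⊩ C → (H ∧' B) ⊩ C → H ⊩ C
∨-cases {H = H} {A} {B} {C} o p q =
  mp o (mp q (mp p (tautology (H ∷ A ∷ B ∷ C ∷ [])
    ((p₀ ∧ᵖ p₁ ⇒ᵖ p₃) ⇒ᵖ (p₀ ∧ᵖ p₂ ⇒ᵖ p₃) ⇒ᵖ (p₀ ⇒ᵖ p₁ ∨ᵖ p₂) ⇒ᵖ (p₀ ⇒ᵖ p₃)) tt)))

by-cases : (H ∧' A) ⊩ C → (H ∧' ¬' A) ⊩ C → H ⊩ C
by-cases {H = H} {A} {C} p q =
  mp q (mp p (tautology (H ∷ A ∷ C ∷ []) ((p₀ ∧ᵖ p₁ ⇒ᵖ p₂) ⇒ᵖ (p₀ ∧ᵖ ¬ᵖ p₁ ⇒ᵖ p₂) ⇒ᵖ (p₀ ⇒ᵖ p₂)) tt))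

contradiction : H ⊩ A → H ⊩ ¬' A → H ⊩ C
contradiction {H = H} {A} {C} p q =
  mp q (mp p (tautology (H ∷ A ∷ C ∷ []) ((p₀ ⇒ᵖ p₁) ⇒ᵖ (p₀ ⇒ᵖ ¬ᵖ p₁) ⇒ᵖ (p₀ ⇒ᵖ p₂)) tt))

¬-intro : (H ∧' A) ⊩ ⊥' → H ⊩ ¬' A
¬-intro {H = H} {A} p =
  mp (ax-refl Z) (mp p (tautology (H ∷ A ∷ ⊤' ∷ []) ((p₀ ∧ᵖ p₁ ⇒ᵖ ¬ᵖ p₂) ⇒ᵖ p₂ ⇒ᵖ (p₀ ⇒ᵖ ¬ᵖ p₁)) tt))

-- Equality

v3 : Tm (suc (suc (suc (suc n))))
v3 = var (suc (suc (suc zero)))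

v4 : Tm (suc (suc (suc (suc (suc n)))))
v4 = var (suc (suc (suc (suc zero))))

inst : {A : Fm n} (ts : Vec (Tm m) n) → ⊢ A → ⊢ substF (lookup ts) A
inst ts = instance-rule (lookup ts)

≐-refl : H ⊩ a ≐ a
≐-refl {a = a} = lift (ax-refl a)

≐-sym : H ⊩ a ≐ b → H ⊩ b ≐ a
≐-sym {a = a} {b} = ⊩-map (ax-sym a b)

≐-transᵛ : ⊢_ {3} (v0 ≐ v1 ⇒ v1 ≐ v2 ⇒ v0 ≐ v2)
≐-transᵛ = mp (ax-eq (v1 ≐ v0) v1 v2)
  (tautology ((v0 ≐ v1) ∷ (v1 ≐ v2) ∷ (v0 ≐ v2) ∷ []) ((p₁ ∧ᵖ p₀ ⇒ᵖ p₂) ⇒ᵖ (p₀ ⇒ᵖ p₁ ⇒ᵖ p₂)) tt)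

infixr 2 _⟫_
_⟫_ : H ⊩ a ≐ b → H ⊩ b ≐ c → H ⊩ a ≐ c
_⟫_ {a = a} {b} {c} p q = ⊩-mp q (⊩-mp p (lift (inst (a ∷ b ∷ c ∷ []) ≐-transᵛ)))

-- Lemmas with suffix ᵛ are stated for variables and used through the
-- instance rule; in inductive ones var 0 is the induction variable.
-- A congruence t(a) ≐ t(b) is the equality axiom for A(x) := t(a) ≐ t(x),
-- whose premise A(a) is reflexivity.
discharge-conjunct : ⊢ (A ∧' B) ⇒ C → ⊢ B → ⊢ A ⇒ C
discharge-conjunct {A = A} {B} {C} p r =
  mp r (mp p (tautology (A ∷ C ∷ B ∷ []) ((p₀ ∧ᵖ p₂ ⇒ᵖ p₁) ⇒ᵖ p₂ ⇒ᵖ (p₀ ⇒ᵖ p₁)) tt))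

cong-Sᵛ : ⊢_ {2} (v0 ≐ v1 ⇒ S v0 ≐ S v1)
cong-Sᵛ = discharge-conjunct (ax-eq (S v1 ≐ S v0) v0 v1) (ax-refl _)

cong₁ᵛ : (f : Fn 1) → ⊢_ {2} (v0 ≐ v1 ⇒ app f (v0 ∷ []) ≐ app f (v1 ∷ []))
cong₁ᵛ f = discharge-conjunct (ax-eq (app f (v1 ∷ []) ≐ app f (v0 ∷ [])) v0 v1) (ax-refl _)

cong₂ˡᵛ : (f : Fn 2) → ⊢_ {3} (v0 ≐ v1 ⇒ app f (v0 ∷ v2 ∷ []) ≐ app f (v1 ∷ v2 ∷ []))
cong₂ˡᵛ f = discharge-conjunct (ax-eq (app f (v1 ∷ v3 ∷ []) ≐ app f (v0 ∷ v3 ∷ [])) v0 v1) (ax-refl _)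

cong₂ʳᵛ : (f : Fn 2) → ⊢_ {3} (v0 ≐ v1 ⇒ app f (v2 ∷ v0 ∷ []) ≐ app f (v2 ∷ v1 ∷ []))
cong₂ʳᵛ f = discharge-conjunct (ax-eq (app f (v3 ∷ v1 ∷ []) ≐ app f (v3 ∷ v0 ∷ [])) v0 v1) (ax-refl _)

cong-C₁ᵛ : ⊢_ {4} (v0 ≐ v1 ⇒ C' v0 v2 v3 ≐ C' v1 v2 v3)
cong-C₁ᵛ = discharge-conjunct (ax-eq (C' v1 v3 v4 ≐ C' v0 v3 v4) v0 v1) (ax-refl _)

cong-C₂ᵛ : ⊢_ {4} (v0 ≐ v1 ⇒ C' v2 v0 v3 ≐ C' v2 v1 v3)
cong-C₂ᵛ = discharge-conjunct (ax-eq (C' v3 v1 v4 ≐ C' v3 v0 v4) v0 v1) (ax-refl _)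

cong-C₃ᵛ : ⊢_ {4} (v0 ≐ v1 ⇒ C' v2 v3 v0 ≐ C' v2 v3 v1)
cong-C₃ᵛ = discharge-conjunct (ax-eq (C' v3 v4 v1 ≐ C' v3 v4 v0) v0 v1) (ax-refl _)

cong-S : H ⊩ a ≐ b → H ⊩ S a ≐ S b
cong-S {a = a} {b} = ⊩-map (inst (a ∷ b ∷ []) cong-Sᵛ)

cong₁ : (f : Fn 1) → H ⊩ a ≐ b → H ⊩ app f (a ∷ []) ≐ app f (b ∷ [])
cong₁ {a = a} {b = b} f = ⊩-map (inst (a ∷ b ∷ []) (cong₁ᵛ f))

cong-app₂ : (f : Fn 2) → H ⊩ a ≐ b → H ⊩ c ≐ d → H ⊩ app f (a ∷ c ∷ []) ≐ app f (b ∷ d ∷ [])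
cong-app₂ {a = a} {b = b} {c = c} {d = d} f p q =
  ⊩-map (inst (a ∷ b ∷ c ∷ []) (cong₂ˡᵛ f)) p ⟫ ⊩-map (inst (c ∷ d ∷ b ∷ []) (cong₂ʳᵛ f)) q

cong-C : {e f : Tm n} → H ⊩ a ≐ b → H ⊩ c ≐ d → H ⊩ e ≐ f → H ⊩ C' a c e ≐ C' b d f
cong-C {a = a} {b = b} {c = c} {d = d} {e = e} {f = f} p q r =
  ⊩-map (inst (a ∷ b ∷ c ∷ e ∷ []) cong-C₁ᵛ) p
  ⟫ ⊩-map (inst (c ∷ d ∷ b ∷ e ∷ []) cong-C₂ᵛ) q
  ⟫ ⊩-map (inst (e ∷ f ∷ b ∷ d ∷ []) cong-C₃ᵛ) r

cong-+ : H ⊩ a ≐ b → H ⊩ c ≐ d → H ⊩ a +' c ≐ b +' d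
cong-+ = cong-app₂ plusF

cong-∸ : H ⊩ a ≐ b → H ⊩ c ≐ d → H ⊩ a -' c ≐ b -' d
cong-∸ = cong-app₂ minusF

cong-* : H ⊩ a ≐ b → H ⊩ c ≐ d → H ⊩ a ·' c ≐ b ·' d
cong-* = cong-app₂ timesF

cong-^ : H ⊩ a ≐ b → H ⊩ c ≐ d → H ⊩ a ↑' c ≐ b ↑' d
cong-^ = cong-app₂ powF

cong-P : H ⊩ a ≐ b → H ⊩ P' a ≐ P' b
cong-P = cong₁ predF

S-injective : H ⊩ S a ≐ S b → H ⊩ a ≐ b
S-injective {a = a} {b = b} = ⊩-map (ax-SS a b)

S≐Z-elim : H ⊩ S a ≐ Z → H ⊩ C
S≐Z-elim {a = a} p = contradiction p (lift (ax-S0 a))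

-- Arithmetic

+-identityʳ : (a : Tm n) → ⊢ a +' Z ≐ a
+-identityʳ a = defZ v0 (S v0) (a ∷ [])

+-suc : (a b : Tm n) → ⊢ a +' S b ≐ S (a +' b)
+-suc a b = defS v0 (S v0) (a ∷ []) b

P-Z : ⊢_ {n} (P' Z ≐ Z)
P-Z = defZ Z v1 []

P-S : (a : Tm n) → ⊢ P' (S a) ≐ a
P-S a = defS Z v1 [] a

∸-identityʳ : (a : Tm n) → ⊢ a -' Z ≐ a
∸-identityʳ a = defZ v0 (P' v0) (a ∷ [])

∸-suc : (a b : Tm n) → ⊢ a -' S b ≐ P' (a -' b)
∸-suc a b = defS v0 (P' v0) (a ∷ []) b

C-Z : (b c : Tm n) → ⊢ C' Z b c ≐ b
C-Z b c = defZ v0 v3 (b ∷ c ∷ [])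

C-S : (a b c : Tm n) → ⊢ C' (S a) b c ≐ c
C-S a b c = defS v0 v3 (b ∷ c ∷ []) a

*-zeroʳ : (a : Tm n) → ⊢ a ·' Z ≐ Z
*-zeroʳ a = defZ Z (v2 +' v0) (a ∷ [])

*-suc : (a b : Tm n) → ⊢ a ·' S b ≐ a +' (a ·' b)
*-suc a b = defS Z (v2 +' v0) (a ∷ []) b

^-zeroʳ : (a : Tm n) → ⊢ a ↑' Z ≐ S Z
^-zeroʳ a = defZ (S Z) (v2 ·' v0) (a ∷ [])

^-suc : (a b : Tm n) → ⊢ a ↑' S b ≐ a ·' (a ↑' b)
^-suc a b = defS (S Z) (v2 ·' v0) (a ∷ []) b

+-identityˡ : (a : Tm n) → ⊢ Z +' a ≐ a
+-identityˡ a = inst (a ∷ []) +-identityˡᵛ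
  where
  +-identityˡᵛ : ⊢_ {1} (Z +' v0 ≐ v0)
  +-identityˡᵛ = ind (+-identityʳ Z) (lift (+-suc Z v0) ⟫ cong-S hypothesis)

+-sucˡ : (a b : Tm n) → ⊢ S a +' b ≐ S (a +' b)
+-sucˡ a b = inst (b ∷ a ∷ []) +-sucˡᵛ
  where
  +-sucˡᵛ : ⊢_ {2} (S v1 +' v0 ≐ S (v1 +' v0))
  +-sucˡᵛ = ind (discharge (lift (+-identityʳ (S v0)) ⟫ ≐-sym (cong-S (lift (+-identityʳ v0)))))
                (lift (+-suc (S v1) v0) ⟫ cong-S hypothesis ⟫ cong-S (≐-sym (lift (+-suc v1 v0))))

+-comm : (a b : Tm n) → ⊢ a +' b ≐ b +' a
+-comm a b = inst (b ∷ a ∷ []) +-commᵛ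
  where
  +-commᵛ : ⊢_ {2} (v1 +' v0 ≐ v0 +' v1)
  +-commᵛ = ind (discharge (lift (+-identityʳ v0) ⟫ ≐-sym (lift (+-identityˡ v0))))
                (lift (+-suc v1 v0) ⟫ cong-S hypothesis ⟫ ≐-sym (lift (+-sucˡ v0 v1)))

+-assoc : (a b c : Tm n) → ⊢ (a +' b) +' c ≐ a +' (b +' c)
+-assoc a b c = inst (c ∷ a ∷ b ∷ []) +-assocᵛ
  where
  +-assocᵛ : ⊢_ {3} ((v1 +' v2) +' v0 ≐ v1 +' (v2 +' v0))
  +-assocᵛ = ind (discharge (lift (+-identityʳ _) ⟫ cong-+ ≐-refl (≐-sym (lift (+-identityʳ v1)))))
                 (lift (+-suc _ v0) ⟫ cong-S hypothesis ⟫ ≐-sym (lift (+-suc v1 (v2 +' v0)))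
                   ⟫ cong-+ ≐-refl (≐-sym (lift (+-suc v2 v0))))

m+1≐S[m] : (a : Tm n) → ⊢ a +' S Z ≐ S a
m+1≐S[m] a = discharge (lift (+-suc a Z) ⟫ cong-S (lift (+-identityʳ a)))

*-zeroˡ : (a : Tm n) → ⊢ Z ·' a ≐ Z
*-zeroˡ a = inst (a ∷ []) *-zeroˡᵛ
  where
  *-zeroˡᵛ : ⊢_ {1} (Z ·' v0 ≐ Z)
  *-zeroˡᵛ = ind (*-zeroʳ Z) (lift (*-suc Z v0) ⟫ lift (+-identityˡ _) ⟫ hypothesis)

*-sucˡ : (a b : Tm n) → ⊢ S a ·' b ≐ (a ·' b) +' b
*-sucˡ a b = inst (b ∷ a ∷ []) *-sucˡᵛ
  where
  *-sucˡᵛ : ⊢_ {2} (S v1 ·' v0 ≐ (v1 ·' v0) +' v0)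
  *-sucˡᵛ = ind (discharge (lift (*-zeroʳ _) ⟫ ≐-sym (lift (+-identityʳ _) ⟫ lift (*-zeroʳ v0))))
                (lift (*-suc (S v1) v0) ⟫ cong-+ ≐-refl hypothesis ⟫ lift (+-sucˡ v1 _)
                  ⟫ cong-S (≐-sym (lift (+-assoc v1 (v1 ·' v0) v0)))
                  ⟫ ≐-sym (lift (+-suc _ v0)) ⟫ cong-+ (≐-sym (lift (*-suc v1 v0))) ≐-refl)

*-identityʳ : (a : Tm n) → ⊢ a ·' S Z ≐ a
*-identityʳ a = discharge (lift (*-suc a Z) ⟫ cong-+ ≐-refl (lift (*-zeroʳ a)) ⟫ lift (+-identityʳ a))

2*n≐n+n : (a : Tm n) → ⊢ two ·' a ≐ a +' a
2*n≐n+n a = discharge (lift (*-sucˡ (S Z) a)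
  ⟫ cong-+ (lift (*-sucˡ Z a) ⟫ cong-+ (lift (*-zeroˡ a)) ≐-refl ⟫ lift (+-identityˡ a)) ≐-refl)

*-comm : (a b : Tm n) → ⊢ a ·' b ≐ b ·' a
*-comm a b = inst (b ∷ a ∷ []) *-commᵛ
  where
  *-commᵛ : ⊢_ {2} (v1 ·' v0 ≐ v0 ·' v1)
  *-commᵛ = ind (discharge (lift (*-zeroʳ v0) ⟫ ≐-sym (lift (*-zeroˡ v0))))
                (lift (*-suc v1 v0) ⟫ cong-+ ≐-refl hypothesis ⟫ lift (+-comm v1 (v0 ·' v1))
                  ⟫ ≐-sym (lift (*-sucˡ v0 v1)))

*-distribˡ-+ : (a b c : Tm n) → ⊢ a ·' (b +' c) ≐ (a ·' b) +' (a ·' c)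
*-distribˡ-+ a b c = inst (c ∷ a ∷ b ∷ []) *-distribˡ-+ᵛ
  where
  *-distribˡ-+ᵛ : ⊢_ {3} (v1 ·' (v2 +' v0) ≐ (v1 ·' v2) +' (v1 ·' v0))
  *-distribˡ-+ᵛ =
    ind (discharge (cong-* ≐-refl (lift (+-identityʳ _)) ⟫ ≐-sym (lift (+-identityʳ _))
                     ⟫ cong-+ ≐-refl (≐-sym (lift (*-zeroʳ v0)))))
        (cong-* ≐-refl (lift (+-suc v2 v0)) ⟫ lift (*-suc v1 _) ⟫ cong-+ ≐-refl hypothesis
          ⟫ ≐-sym (lift (+-assoc v1 _ _)) ⟫ cong-+ (lift (+-comm v1 _)) ≐-refl ⟫ lift (+-assoc _ v1 _)
          ⟫ cong-+ ≐-refl (≐-sym (lift (*-suc v1 v0))))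

*-distribʳ-+ : (a b c : Tm n) → ⊢ (a +' b) ·' c ≐ (a ·' c) +' (b ·' c)
*-distribʳ-+ a b c = discharge (lift (*-comm _ c) ⟫ lift (*-distribˡ-+ c a b)
  ⟫ cong-+ (lift (*-comm c a)) (lift (*-comm c b)))

*-assoc : (a b c : Tm n) → ⊢ (a ·' b) ·' c ≐ a ·' (b ·' c)
*-assoc a b c = inst (c ∷ a ∷ b ∷ []) *-assocᵛ
  where
  *-assocᵛ : ⊢_ {3} ((v1 ·' v2) ·' v0 ≐ v1 ·' (v2 ·' v0))
  *-assocᵛ = ind (discharge (lift (*-zeroʳ _) ⟫ ≐-sym (lift (*-zeroʳ v0))
                              ⟫ cong-* ≐-refl (≐-sym (lift (*-zeroʳ v1)))))
                 (lift (*-suc _ v0) ⟫ cong-+ ≐-refl hypothesis ⟫ ≐-sym (lift (*-distribˡ-+ v1 v2 _))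
                   ⟫ cong-* ≐-refl (≐-sym (lift (*-suc v2 v0))))

^-distribˡ-+-* : (a b c : Tm n) → ⊢ a ↑' (b +' c) ≐ (a ↑' b) ·' (a ↑' c)
^-distribˡ-+-* a b c = inst (c ∷ a ∷ b ∷ []) ^-distribˡ-+-*ᵛ
  where
  ^-distribˡ-+-*ᵛ : ⊢_ {3} (v1 ↑' (v2 +' v0) ≐ (v1 ↑' v2) ·' (v1 ↑' v0))
  ^-distribˡ-+-*ᵛ =
    ind (discharge (cong-^ ≐-refl (lift (+-identityʳ _)) ⟫ ≐-sym (lift (*-identityʳ _))
                     ⟫ cong-* ≐-refl (≐-sym (lift (^-zeroʳ v0)))))
        (cong-^ ≐-refl (lift (+-suc v2 v0)) ⟫ lift (^-suc v1 _) ⟫ cong-* ≐-refl hypothesis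
          ⟫ ≐-sym (lift (*-assoc v1 _ _)) ⟫ cong-* (lift (*-comm v1 _)) ≐-refl ⟫ lift (*-assoc _ v1 _)
          ⟫ cong-* ≐-refl (≐-sym (lift (^-suc v1 v0))))

0∸n≐0 : (a : Tm n) → ⊢ Z -' a ≐ Z
0∸n≐0 a = inst (a ∷ []) 0∸n≐0ᵛ
  where
  0∸n≐0ᵛ : ⊢_ {1} (Z -' v0 ≐ Z)
  0∸n≐0ᵛ = ind (∸-identityʳ Z) (lift (∸-suc Z v0) ⟫ cong-P hypothesis ⟫ lift P-Z)

P[m∸n]≐P[m]∸n : (a b : Tm n) → ⊢ P' (a -' b) ≐ P' a -' b
P[m∸n]≐P[m]∸n a b = inst (b ∷ a ∷ []) P[m∸n]≐P[m]∸nᵛ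
  where
  P[m∸n]≐P[m]∸nᵛ : ⊢_ {2} (P' (v1 -' v0) ≐ P' v1 -' v0)
  P[m∸n]≐P[m]∸nᵛ = ind (discharge (cong-P (lift (∸-identityʳ _)) ⟫ ≐-sym (lift (∸-identityʳ _))))
                       (cong-P (lift (∸-suc v1 v0)) ⟫ cong-P hypothesis ⟫ ≐-sym (lift (∸-suc _ v0)))

S[m]∸S[n]≐m∸n : (a b : Tm n) → ⊢ S a -' S b ≐ a -' b
S[m]∸S[n]≐m∸n a b =
  discharge (lift (∸-suc (S a) b) ⟫ lift (P[m∸n]≐P[m]∸n (S a) b) ⟫ cong-∸ (lift (P-S a)) ≐-refl)

n∸n≐0 : (a : Tm n) → ⊢ a -' a ≐ Z
n∸n≐0 a = inst (a ∷ []) n∸n≐0ᵛ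
  where
  n∸n≐0ᵛ : ⊢_ {1} (v0 -' v0 ≐ Z)
  n∸n≐0ᵛ = ind (∸-identityʳ Z) (lift (S[m]∸S[n]≐m∸n v0 v0) ⟫ hypothesis)

[m+o]∸[n+o]≐m∸n : (a b c : Tm n) → ⊢ (a +' c) -' (b +' c) ≐ a -' b
[m+o]∸[n+o]≐m∸n a b c = inst (c ∷ a ∷ b ∷ []) [m+o]∸[n+o]≐m∸nᵛ
  where
  [m+o]∸[n+o]≐m∸nᵛ : ⊢_ {3} ((v1 +' v0) -' (v2 +' v0) ≐ v1 -' v2)
  [m+o]∸[n+o]≐m∸nᵛ = ind (discharge (cong-∸ (lift (+-identityʳ _)) (lift (+-identityʳ _))))
                         (cong-∸ (lift (+-suc v1 v0)) (lift (+-suc v2 v0)) ⟫ lift (S[m]∸S[n]≐m∸n _ _) ⟫ hypothesis)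

m+n∸m≐n : (a b : Tm n) → ⊢ (a +' b) -' a ≐ b
m+n∸m≐n a b = discharge (cong-∸ (lift (+-comm a b)) (≐-sym (lift (+-identityˡ a)))
  ⟫ lift ([m+o]∸[n+o]≐m∸n b Z a) ⟫ lift (∸-identityʳ b))

m∸[m+n]≐0 : (a b : Tm n) → ⊢ a -' (a +' b) ≐ Z
m∸[m+n]≐0 a b = discharge (cong-∸ (≐-sym (lift (+-identityˡ a))) (lift (+-comm a b))
  ⟫ lift ([m+o]∸[n+o]≐m∸n Z b a) ⟫ lift (0∸n≐0 b))

S[m]∸m≐1 : (a : Tm n) → ⊢ S a -' a ≐ S Z
S[m]∸m≐1 a = discharge (cong-∸ (≐-sym (lift (m+1≐S[m] a))) ≐-refl ⟫ lift (m+n∸m≐n a (S Z)))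

Z-S-cases : (a : Tm n) → (H ∧' a ≐ Z) ⊩ C → (H ∧' a ≐ S (P' a)) ⊩ C → H ⊩ C
Z-S-cases a = ∨-cases (lift (inst (a ∷ []) Z-or-Sᵛ))
  where
  Z-or-Sᵛ : ⊢_ {1} (v0 ≐ Z ∨' v0 ≐ S (P' v0))
  Z-or-Sᵛ = ind (discharge (∨-introˡ ≐-refl)) (∨-introʳ (cong-S (≐-sym (lift (P-S v0)))))

m+n≐0⇒n≐0 : H ⊩ a +' b ≐ Z → H ⊩ b ≐ Z
m+n≐0⇒n≐0 {a = a} {b = b} p =
  Z-S-cases b assumption (S≐Z-elim (≐-sym (lift (+-suc a _)) ⟫ cong-+ ≐-refl (≐-sym assumption) ⟫ weaken p))

m+n≐0⇒m≐0 : H ⊩ a +' b ≐ Z → H ⊩ a ≐ Z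
m+n≐0⇒m≐0 {a = a} {b = b} p = m+n≐0⇒n≐0 (lift (+-comm b a) ⟫ p)

-- Order

S[m]≤m-elim : H ⊩ S a ≤' a → H ⊩ C
S[m]≤m-elim {a = a} p = S≐Z-elim (≐-sym (lift (S[m]∸m≐1 a)) ⟫ p)

m+[n∸m]≐n : H ⊩ a ≤' b → H ⊩ a +' (b -' a) ≐ b
m+[n∸m]≐n {a = a} {b = b} p = ⊩-mp p (lift (inst (a ∷ b ∷ []) m+[n∸m]≐nᵛ))
  where
  IH : Fm 2
  IH = v0 ≤' v1 ⇒ v0 +' (v1 -' v0) ≐ v1

  m≤n : (IH ∧' S v0 ≤' v1) ⊩ v0 ≤' v1
  m≤n = cong-∸ (≐-sym (lift (P-S v0))) ≐-refl ⟫ ≐-sym (lift (P[m∸n]≐P[m]∸n (S v0) v1))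
    ⟫ cong-P assumption ⟫ lift P-Z

  IH-applied : (IH ∧' S v0 ≤' v1) ⊩ v0 +' (v1 -' v0) ≐ v1
  IH-applied = ⊩-mp m≤n (weaken hypothesis)

  m+[n∸m]≐nᵛ : ⊢ IH
  m+[n∸m]≐nᵛ = ind (lift (discharge (lift (+-identityˡ _) ⟫ lift (∸-identityʳ v0))))
    (⇒-intro (Z-S-cases (v1 -' v0)
      (S[m]≤m-elim (cong-∸ ≐-refl (≐-sym (lift (+-identityʳ v0)) ⟫ cong-+ ≐-refl (≐-sym assumption)
                                    ⟫ weaken IH-applied)
                    ⟫ weaken assumption))
      (cong-+ ≐-refl (lift (∸-suc v1 v0)) ⟫ lift (+-sucˡ v0 _) ⟫ ≐-sym (lift (+-suc v0 _))
        ⟫ cong-+ ≐-refl (≐-sym assumption) ⟫ weaken IH-applied)))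

≤-refl : (a : Tm n) → H ⊩ a ≤' a
≤-refl a = lift (n∸n≐0 a)

m≤m+n : (a b : Tm n) → H ⊩ a ≤' (a +' b)
m≤m+n a b = lift (m∸[m+n]≐0 a b)

n≤S[n] : (a : Tm n) → H ⊩ a ≤' S a
n≤S[n] a = cong-∸ ≐-refl (≐-sym (lift (m+1≐S[m] a))) ⟫ m≤m+n a (S Z)

≤-respˡ-≐ : H ⊩ a ≐ b → H ⊩ b ≤' c → H ⊩ a ≤' c
≤-respˡ-≐ p q = cong-∸ p ≐-refl ⟫ q

≤-respʳ-≐ : H ⊩ a ≤' b → H ⊩ b ≐ c → H ⊩ a ≤' c
≤-respʳ-≐ p q = cong-∸ ≐-refl (≐-sym q) ⟫ p

≤-trans : H ⊩ a ≤' b → H ⊩ b ≤' c → H ⊩ a ≤' c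
≤-trans p q = ≤-respʳ-≐ (m≤m+n _ _)
  (≐-sym (lift (+-assoc _ _ _)) ⟫ cong-+ (m+[n∸m]≐n p) ≐-refl ⟫ m+[n∸m]≐n q)

≤-antisym : H ⊩ a ≤' b → H ⊩ b ≤' a → H ⊩ a ≐ b
≤-antisym {a = a} p q = ≐-sym (lift (+-identityʳ a)) ⟫ cong-+ ≐-refl (≐-sym q) ⟫ m+[n∸m]≐n p

≤∧∸≐S⇒S≤ : H ⊩ a ≤' b → H ⊩ b -' a ≐ S c → H ⊩ S a ≤' b
≤∧∸≐S⇒S≤ {a = a} {c = c} p q =
  cong-∸ ≐-refl (≐-sym (m+[n∸m]≐n p) ⟫ cong-+ ≐-refl q ⟫ lift (+-suc a c) ⟫ ≐-sym (lift (+-sucˡ a c)))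
  ⟫ m≤m+n (S a) c

≤-total : (a b : Tm n) → ⊢ a ≤' b ∨' b ≤' a
≤-total a b = inst (b ∷ a ∷ []) ≤-totalᵛ
  where
  ≤-totalᵛ : ⊢_ {2} (v1 ≤' v0 ∨' v0 ≤' v1)
  ≤-totalᵛ = ind (discharge (∨-introʳ (lift (0∸n≐0 v0))))
    (∨-cases hypothesis
      (∨-introˡ (≤-trans assumption (n≤S[n] v0)))
      (Z-S-cases (v1 -' v0)
        (∨-introˡ (≤-respˡ-≐ (≐-sym (≤-antisym (weaken assumption) assumption)) (n≤S[n] v0)))
        (∨-introʳ (≤∧∸≐S⇒S≤ (weaken assumption) assumption))))

<⇒S≤ : H ⊩ a <' b → H ⊩ S a ≤' b
<⇒S≤ {a = a} {b = b} p = Z-S-cases (b -' a)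
  (contradiction (≤-antisym (weaken (∧-elimˡ p)) assumption) (weaken (∧-elimʳ p)))
  (≤∧∸≐S⇒S≤ (weaken (∧-elimˡ p)) assumption)

S≤⇒< : H ⊩ S a ≤' b → H ⊩ a <' b
S≤⇒< {a = a} p = ∧-intro (≤-trans (n≤S[n] a) p) (¬-intro (S[m]≤m-elim (cong-∸ ≐-refl assumption ⟫ weaken p)))

≤∧¬<⇒≐ : H ⊩ a ≤' b → H ⊩ ¬' (a <' b) → H ⊩ a ≐ b
≤∧¬<⇒≐ p q = by-cases assumption (contradiction (∧-intro (weaken p) assumption) (weaken q))

≤S∧≰⇒≐S : H ⊩ a ≤' S b → H ⊩ ¬' (a ≤' b) → H ⊩ a ≐ S b
≤S∧≰⇒≐S {a = a} {b = b} p q = ∨-cases (lift (≤-total a b))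
  (contradiction assumption (weaken q))
  (≤-antisym (weaken p)
    (<⇒S≤ (∧-intro assumption
      (¬-intro (contradiction (≤-respˡ-≐ (≐-sym assumption) (≤-refl b)) (weaken (weaken q)))))))

+-monoˡ-≤ : (c : Tm n) → H ⊩ a ≤' b → H ⊩ (a +' c) ≤' (b +' c)
+-monoˡ-≤ c p = lift ([m+o]∸[n+o]≐m∸n _ _ c) ⟫ p

+-monoʳ-≤ : (c : Tm n) → H ⊩ a ≤' b → H ⊩ (c +' a) ≤' (c +' b)
+-monoʳ-≤ c p = cong-∸ (lift (+-comm c _)) (lift (+-comm c _)) ⟫ +-monoˡ-≤ c p

+-cancelʳ-≤ : (c : Tm n) → H ⊩ (a +' c) ≤' (b +' c) → H ⊩ a ≤' b
+-cancelʳ-≤ c p = ≐-sym (lift ([m+o]∸[n+o]≐m∸n _ _ c)) ⟫ p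

*-monoˡ-≤ : (c : Tm n) → H ⊩ a ≤' b → H ⊩ (a ·' c) ≤' (b ·' c)
*-monoˡ-≤ c p =
  cong-∸ ≐-refl (cong-* (≐-sym (m+[n∸m]≐n p)) ≐-refl ⟫ lift (*-distribʳ-+ _ _ c)) ⟫ m≤m+n _ _

1≤S[n] : (a : Tm n) → ⊢ S Z ≤' S a
1≤S[n] a = discharge (lift (S[m]∸S[n]≐m∸n Z a) ⟫ lift (0∸n≐0 a))

1≤n⇒n≐S[P[n]] : H ⊩ S Z ≤' a → H ⊩ a ≐ S (P' a)
1≤n⇒n≐S[P[n]] {a = a} p = Z-S-cases a (S[m]≤m-elim (≤-respʳ-≐ (weaken p) assumption)) assumption

m≤m*n : (a : Tm n) → H ⊩ S Z ≤' b → H ⊩ a ≤' (a ·' b)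
m≤m*n a p = ≤-respʳ-≐ (m≤m+n a _) (≐-sym (cong-* ≐-refl (1≤n⇒n≐S[P[n]] p) ⟫ lift (*-suc a _)))

S[n]≤2^n : (a : Tm n) → ⊢ S a ≤' (two ↑' a)
S[n]≤2^n a = inst (a ∷ []) S[n]≤2^nᵛ
  where
  S[n]≤2^nᵛ : ⊢_ {1} (S v0 ≤' (two ↑' v0))
  S[n]≤2^nᵛ = ind (discharge (cong-∸ ≐-refl (lift (^-zeroʳ two)) ⟫ lift (n∸n≐0 _)))
    (≤-respˡ-≐ (≐-sym (lift (m+1≐S[m] (S v0))))
      (≤-trans (+-monoˡ-≤ (S Z) hypothesis)
        (≤-respʳ-≐ (+-monoʳ-≤ (two ↑' v0) (≤-trans (lift (1≤S[n] v0)) hypothesis))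
          (≐-sym (lift (^-suc two v0) ⟫ lift (2*n≐n+n _))))))

n≤2^n : (a : Tm n) → H ⊩ a ≤' (two ↑' a)
n≤2^n a = ≤-trans (n≤S[n] a) (lift (S[n]≤2^n a))

1≤2^n : (a : Tm n) → H ⊩ S Z ≤' (two ↑' a)
1≤2^n a = ≤-trans (lift (1≤S[n] a)) (lift (S[n]≤2^n a))

2^-mono-≤ : H ⊩ a ≤' b → H ⊩ (two ↑' a) ≤' (two ↑' b)
2^-mono-≤ {a = a} {b = b} p = ≤-respʳ-≐ (m≤m*n _ (1≤2^n (b -' a)))
  (≐-sym (lift (^-distribˡ-+-* two a _)) ⟫ cong-^ ≐-refl (m+[n∸m]≐n p))

-- Characteristic functions

χ-correct : (A : Fm n) → ⊢ (χ A ≐ Z) ⇔' A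
χ-correct (s ≐ t) = inst (s ∷ t ∷ []) χ-≐ᵛ
  where
  χ-≐ᵛ : ⊢_ {2} (C' (Eq' v0 v1) Z (S Z) ≐ Z ⇔' v0 ≐ v1)
  χ-≐ᵛ = discharge (∧-intro
    (⇒-intro (Z-S-cases (Eq' v0 v1)
      (≤-antisym (m+n≐0⇒m≐0 assumption) (m+n≐0⇒n≐0 assumption))
      (S≐Z-elim (≐-sym (cong-C assumption ≐-refl ≐-refl ⟫ lift (C-S _ _ _)) ⟫ weaken assumption))))
    (⇒-intro (cong-C (cong-+ (cong-∸ ≐-refl (≐-sym assumption)) (cong-∸ (≐-sym assumption) ≐-refl)
                      ⟫ cong-+ (lift (n∸n≐0 v0)) (lift (n∸n≐0 v0)) ⟫ lift (+-identityʳ Z)) ≐-refl ≐-refl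
              ⟫ lift (C-Z _ _))))
χ-correct (¬' A) = mp (χ-correct A) (mp (inst (χ A ∷ []) χ-¬ᵛ)
  (tautology ((C' (χ A) (S Z) Z ≐ Z) ∷ (χ A ≐ Z) ∷ A ∷ [])
    ((p₀ ⇔ᵖ ¬ᵖ p₁) ⇒ᵖ (p₁ ⇔ᵖ p₂) ⇒ᵖ (p₀ ⇔ᵖ ¬ᵖ p₂)) tt))
  where
  χ-¬ᵛ : ⊢_ {1} (C' v0 (S Z) Z ≐ Z ⇔' ¬' (v0 ≐ Z))
  χ-¬ᵛ = discharge (∧-intro
    (⇒-intro (¬-intro (S≐Z-elim (≐-sym (cong-C assumption ≐-refl ≐-refl ⟫ lift (C-Z _ _)) ⟫ weaken assumption))))
    (⇒-intro (Z-S-cases v0 (contradiction assumption (weaken assumption))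
                           (cong-C assumption ≐-refl ≐-refl ⟫ lift (C-S _ _ _)))))
χ-correct (A ∨' B) = mp (χ-correct B) (mp (χ-correct A) (mp (inst (χ A ∷ χ B ∷ []) χ-∨ᵛ)
  (tautology ((χ (A ∨' B) ≐ Z) ∷ (χ A ≐ Z) ∷ (χ B ≐ Z) ∷ A ∷ B ∷ [])
    ((p₀ ⇔ᵖ (p₁ ∨ᵖ p₂)) ⇒ᵖ (p₁ ⇔ᵖ p₃) ⇒ᵖ (p₂ ⇔ᵖ p₄) ⇒ᵖ (p₀ ⇔ᵖ (p₃ ∨ᵖ p₄))) tt)))
  where
  χ-∨ᵛ : ⊢_ {2} (C' v0 Z (C' v1 Z (S Z)) ≐ Z ⇔' (v0 ≐ Z ∨' v1 ≐ Z))
  χ-∨ᵛ = discharge (∧-intro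
    (⇒-intro (Z-S-cases v0 (∨-introˡ assumption)
      (Z-S-cases v1 (∨-introʳ assumption)
        (S≐Z-elim (≐-sym (cong-C (weaken assumption) ≐-refl (cong-C assumption ≐-refl ≐-refl)
                          ⟫ lift (C-S _ _ _) ⟫ lift (C-S _ _ _))
                   ⟫ weaken (weaken assumption))))))
    (⇒-intro (∨-cases assumption (cong-C assumption ≐-refl ≐-refl ⟫ lift (C-Z _ _))
      (Z-S-cases v0 (cong-C assumption ≐-refl ≐-refl ⟫ lift (C-Z _ _))
        (cong-C assumption ≐-refl (cong-C (weaken assumption) ≐-refl ≐-refl ⟫ lift (C-Z _ _))
         ⟫ lift (C-S _ _ _))))))

χ-complete : H ⊩ A → H ⊩ χ A ≐ Z
χ-complete {A = A} p = ⊩-mp p (∧-elimʳ (lift (χ-correct A)))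

χ-sound : H ⊩ χ A ≐ Z → H ⊩ A
χ-sound {A = A} p = ⊩-mp p (∧-elimˡ (lift (χ-correct A)))

if-true : H ⊩ A → H ⊩ C' (χ A) b c ≐ b
if-true p = cong-C (χ-complete p) ≐-refl ≐-refl ⟫ lift (C-Z _ _)

if-false : H ⊩ ¬' A → H ⊩ C' (χ A) b c ≐ c
if-false {A = A} p =
  Z-S-cases (χ A) (contradiction (χ-sound assumption) (weaken p)) (cong-C assumption ≐-refl ≐-refl ⟫ lift (C-S _ _ _))

-- Substitution

mutual
  substT-∘ : (σ : Fin m → Tm k) (τ : Fin n → Tm m) (t : Tm n) →
             substT σ (substT τ t) ≡ substT (λ i → substT σ (τ i)) t
  substT-∘ σ τ (var i)    = refl
  substT-∘ σ τ Z          = refl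
  substT-∘ σ τ (S t)      = cong S (substT-∘ σ τ t)
  substT-∘ σ τ (app f ts) = cong (app f) (substV-∘ σ τ ts)

  substV-∘ : (σ : Fin m → Tm k) (τ : Fin n → Tm m) (ts : Vec (Tm n) j) →
             substV σ (substV τ ts) ≡ substV (λ i → substT σ (τ i)) ts
  substV-∘ σ τ []       = refl
  substV-∘ σ τ (t ∷ ts) = cong₂ _∷_ (substT-∘ σ τ t) (substV-∘ σ τ ts)

substF-∘ : (σ : Fin m → Tm k) (τ : Fin n → Tm m) (A : Fm n) →
           substF σ (substF τ A) ≡ substF (λ i → substT σ (τ i)) A
substF-∘ σ τ (s ≐ t)  = cong₂ _≐_ (substT-∘ σ τ s) (substT-∘ σ τ t)
substF-∘ σ τ (¬' A)   = cong ¬'_ (substF-∘ σ τ A)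
substF-∘ σ τ (A ∨' B) = cong₂ _∨'_ (substF-∘ σ τ A) (substF-∘ σ τ B)

mutual
  substT-cong : {σ τ : Fin n → Tm m} → (∀ i → σ i ≡ τ i) → (t : Tm n) → substT σ t ≡ substT τ t
  substT-cong eq (var i)    = eq i
  substT-cong eq Z          = refl
  substT-cong eq (S t)      = cong S (substT-cong eq t)
  substT-cong eq (app f ts) = cong (app f) (substV-cong eq ts)

  substV-cong : {σ τ : Fin n → Tm m} → (∀ i → σ i ≡ τ i) → (ts : Vec (Tm n) j) → substV σ ts ≡ substV τ ts
  substV-cong eq []       = refl
  substV-cong eq (t ∷ ts) = cong₂ _∷_ (substT-cong eq t) (substV-cong eq ts)

substF-cong : {σ τ : Fin n → Tm m} → (∀ i → σ i ≡ τ i) → (A : Fm n) → substF σ A ≡ substF τ A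
substF-cong eq (s ≐ t)  = cong₂ _≐_ (substT-cong eq s) (substT-cong eq t)
substF-cong eq (¬' A)   = cong ¬'_ (substF-cong eq A)
substF-cong eq (A ∨' B) = cong₂ _∨'_ (substF-cong eq A) (substF-cong eq B)

mutual
  substT-var : (t : Tm n) → substT var t ≡ t
  substT-var (var i)    = refl
  substT-var Z          = refl
  substT-var (S t)      = cong S (substT-var t)
  substT-var (app f ts) = cong (app f) (substV-var ts)

  substV-var : (ts : Vec (Tm n) j) → substV var ts ≡ ts
  substV-var []       = refl
  substV-var (t ∷ ts) = cong₂ _∷_ (substT-var t) (substV-var ts)

substT-χ : (σ : Fin n → Tm m) (A : Fm n) → substT σ (χ A) ≡ χ (substF σ A)
substT-χ σ (s ≐ t)  = refl
substT-χ σ (¬' A)   = cong (λ u → C' u (S Z) Z) (substT-χ σ A)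
substT-χ σ (A ∨' B) = cong₂ (λ u w → C' u Z (C' w Z (S Z))) (substT-χ σ A) (substT-χ σ B)

shift : Tm n → Tm (suc n)
shift = substT (λ i → var (suc i))

substT-inst0-shift : (s t : Tm n) → substT (inst0 s) (shift t) ≡ t
substT-inst0-shift s t = trans (substT-∘ _ _ t) (substT-var t)

⊢-cast : A ≡ B → ⊢ A → ⊢ B
⊢-cast = subst ⊢_

-- Bounded minimisation, for formulas  B : Fm 2  in the variables q (var 0)
-- and y (var 1).

infix 10 _⟨_,_⟩
_⟨_,_⟩ : Fm 2 → Tm n → Tm n → Fm n
B ⟨ q , y ⟩ = substF (lookup (q ∷ y ∷ [])) B

substF-⟨⟩ : (σ : Fin n → Tm m) (B : Fm 2) (q y : Tm n) →
            substF σ (B ⟨ q , y ⟩) ≡ B ⟨ substT σ q , substT σ y ⟩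
substF-⟨⟩ σ B q y = trans (substF-∘ σ _ B) (substF-cong (λ { zero → refl ; (suc zero) → refl }) B)

substT-χ-⟨⟩ : (σ : Fin m → Tm n) (τ : Fin 2 → Tm m) (B : Fm 2) {q y : Tm n} →
              substT σ (τ zero) ≡ q → substT σ (τ (suc zero)) ≡ y →
              substT σ (χ (substF τ B)) ≡ χ (B ⟨ q , y ⟩)
substT-χ-⟨⟩ σ τ B eq₀ eq₁ = trans (substT-χ σ (substF τ B))
  (cong χ (trans (substF-∘ σ τ B) (substF-cong (λ { zero → eq₀ ; (suc zero) → eq₁ }) B)))

⟨⟩-resp-≐ : (B : Fm 2) {q r y : Tm n} → H ⊩ q ≐ r → H ⊩ B ⟨ q , y ⟩ → H ⊩ B ⟨ r , y ⟩
⟨⟩-resp-≐ B {q = q} {r = r} {y = y} p h = ⊩-map (⊢-cast eq (ax-eq (B ⟨ v0 , shift y ⟩) q r)) (∧-intro p h)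
  where
  inst0-⟨⟩ : ∀ u → substF (inst0 u) (B ⟨ v0 , shift y ⟩) ≡ B ⟨ u , y ⟩
  inst0-⟨⟩ u = trans (substF-⟨⟩ (inst0 u) B v0 (shift y)) (cong (B ⟨ u ,_⟩) (substT-inst0-shift u y))
  eq : ((q ≐ r) ∧' substF (inst0 q) (B ⟨ v0 , shift y ⟩) ⇒ substF (inst0 r) (B ⟨ v0 , shift y ⟩))
       ≡ ((q ≐ r ∧' B ⟨ q , y ⟩) ⇒ B ⟨ r , y ⟩)
  eq = cong₂ (λ X Y → (q ≐ r) ∧' X ⇒ Y) (inst0-⟨⟩ q) (inst0-⟨⟩ r)

-- μ B y b is the least q ≤ b with B ⟨ q , y ⟩, and S b if there is none.
μ : Fm 2 → Tm n → Tm n → Tm n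
μ B y b = app (μF B) (y ∷ b ∷ [])

μ-Z : (B : Fm 2) (y : Tm n) → ⊢ μ B y Z ≐ C' (χ (B ⟨ Z , y ⟩)) Z (S Z)
μ-Z B y = subst (λ u → ⊢ μ B y Z ≐ C' u Z (S Z)) (substT-χ-⟨⟩ _ _ B refl refl) (defZ _ _ (y ∷ []))

μ-S : (B : Fm 2) (y b : Tm n) →
      ⊢ μ B y (S b) ≐ C' (χ (μ B y b ≤' b)) (μ B y b) (C' (χ (B ⟨ S b , y ⟩)) (S b) (S (S b)))
μ-S B y b = subst (λ u → ⊢ μ B y (S b) ≐ C' (χ (μ B y b ≤' b)) (μ B y b) (C' u (S b) (S (S b))))
                  (substT-χ-⟨⟩ _ _ B refl refl) (defS _ _ (y ∷ []) b)

μ≤⇒B : (B : Fm 2) {y b : Tm n} → H ⊩ μ B y b ≤' b → H ⊩ B ⟨ μ B y b , y ⟩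
μ≤⇒B B {y = y} {b = b} = ⊩-map (⊢-cast (cong (μ B y b ≤' b ⇒_) (substF-⟨⟩ _ B (μ B v1 v0) v1))
                                        (inst (b ∷ y ∷ []) μ≤⇒Bᵛ))
  where
  base : ⊢ μ B v0 Z ≤' Z ⇒ B ⟨ μ B v0 Z , v0 ⟩
  base = by-cases (⟨⟩-resp-≐ B (≐-sym (lift (μ-Z B v0) ⟫ if-true assumption)) assumption)
                  (S[m]≤m-elim (≤-respˡ-≐ (≐-sym (lift (μ-Z B v0) ⟫ if-false assumption)) (weaken hypothesis)))

  step : ⊢ (μ B v1 v0 ≤' v0 ⇒ B ⟨ μ B v1 v0 , v1 ⟩) ⇒ (μ B v1 (S v0) ≤' S v0 ⇒ B ⟨ μ B v1 (S v0) , v1 ⟩)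
  step = ⇒-intro (by-cases
    (⟨⟩-resp-≐ B (≐-sym (lift (μ-S B v1 v0) ⟫ if-true assumption)) (⊩-mp assumption (weaken (weaken hypothesis))))
    (by-cases
      (⟨⟩-resp-≐ B (≐-sym (lift (μ-S B v1 v0) ⟫ if-false (weaken assumption) ⟫ if-true assumption)) assumption)
      (S[m]≤m-elim (≤-respˡ-≐ (≐-sym (lift (μ-S B v1 v0) ⟫ if-false (weaken assumption) ⟫ if-false assumption))
                              (weaken (weaken assumption))))))

  μ≤⇒Bᵛ : ⊢_ {2} (μ B v1 v0 ≤' v0 ⇒ B ⟨ μ B v1 v0 , v1 ⟩)
  μ≤⇒Bᵛ = ind (⊢-cast (cong (μ B v0 Z ≤' Z ⇒_) (sym (substF-⟨⟩ (inst0 Z) B (μ B v1 v0) v1))) base)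
              (⊢-cast (cong (λ X → (μ B v1 v0 ≤' v0 ⇒ B ⟨ μ B v1 v0 , v1 ⟩) ⇒ (μ B v1 (S v0) ≤' S v0 ⇒ X))
                            (sym (substF-⟨⟩ (repl0 (S v0)) B (μ B v1 v0) v1))) step)

B∧≤⇒μ≤ : (B : Fm 2) {q y b : Tm n} → H ⊩ B ⟨ q , y ⟩ → H ⊩ q ≤' b → H ⊩ μ B y b ≤' b
B∧≤⇒μ≤ B {q = q} {y = y} {b = b} h p =
  ⊩-map (⊢-cast (cong (λ X → (X ∧' q ≤' b) ⇒ μ B y b ≤' b) (substF-⟨⟩ _ B v2 v1))
                (inst (b ∷ y ∷ q ∷ []) B∧≤⇒μ≤ᵛ))
        (∧-intro h p)
  where
  base : ⊢ (B ⟨ v1 , v0 ⟩ ∧' v1 ≤' Z) ⇒ μ B v0 Z ≤' Z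
  base = ≤-respˡ-≐ (lift (μ-Z B v0) ⟫ if-true (⟨⟩-resp-≐ B (≐-sym (lift (∸-identityʳ v1)) ⟫ ∧-elimʳ hypothesis)
                                                            (∧-elimˡ hypothesis)))
                   (≤-refl Z)

  IH : Fm 3
  IH = (B ⟨ v2 , v1 ⟩ ∧' v2 ≤' v0) ⇒ μ B v1 v0 ≤' v0

  -- by the induction hypothesis, the witness v2 lies above v0 if μ does
  witness≰ : ((IH ∧' (B ⟨ v2 , v1 ⟩ ∧' v2 ≤' S v0)) ∧' ¬' (μ B v1 v0 ≤' v0)) ⊩ ¬' (v2 ≤' v0)
  witness≰ = ¬-intro (contradiction
    (⊩-mp (∧-intro (∧-elimˡ (∧-elimʳ (weaken (weaken hypothesis)))) assumption)
          (∧-elimˡ (weaken (weaken hypothesis))))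
    (weaken assumption))

  step : ⊢ IH ⇒ ((B ⟨ v2 , v1 ⟩ ∧' v2 ≤' S v0) ⇒ μ B v1 (S v0) ≤' S v0)
  step = ⇒-intro (by-cases
    (≤-respˡ-≐ (lift (μ-S B v1 v0) ⟫ if-true assumption) (≤-trans assumption (n≤S[n] v0)))
    (≤-respˡ-≐ (lift (μ-S B v1 v0) ⟫ if-false assumption
                ⟫ if-true (⟨⟩-resp-≐ B (≤S∧≰⇒≐S (∧-elimʳ (weaken assumption)) witness≰)
                                       (∧-elimˡ (weaken assumption))))
               (≤-refl (S v0))))

  B∧≤⇒μ≤ᵛ : ⊢_ {3} IH
  B∧≤⇒μ≤ᵛ = ind (⊢-cast (cong (λ X → (X ∧' v1 ≤' Z) ⇒ μ B v0 Z ≤' Z) (sym (substF-⟨⟩ (inst0 Z) B v2 v1)))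
                        base)
                (⊢-cast (cong (λ X → IH ⇒ ((X ∧' v2 ≤' S v0) ⇒ μ B v1 (S v0) ≤' S v0))
                              (sym (substF-⟨⟩ (repl0 (S v0)) B v2 v1))) step)

μ-witness : (B : Fm 2) {q y b : Tm n} → H ⊩ B ⟨ q , y ⟩ → H ⊩ q ≤' b → H ⊩ B ⟨ μ B y b , y ⟩
μ-witness B h p = μ≤⇒B B (B∧≤⇒μ≤ B h p)

-- Powers of two

-- the exponent found by the bounded search in  isPow2 p
log₂ : Tm n → Tm n
log₂ p = μ pow2B p p

isPow2-intro : H ⊩ two ↑' a ≐ b → H ⊩ a ≤' b → H ⊩ isPow2 b
isPow2-intro = μ-witness pow2B

isPow2⇒1≤ : H ⊩ isPow2 a → H ⊩ S Z ≤' a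
isPow2⇒1≤ {a = a} h = ≤-respʳ-≐ (1≤2^n (log₂ a)) h

isPow2-double : H ⊩ isPow2 a → H ⊩ isPow2 (two ·' a)
isPow2-double {H = H} {a = a} h = isPow2-intro 2^[1+log₂a]≐2a (≤-respʳ-≐ (n≤2^n _) 2^[1+log₂a]≐2a)
  where
  2^[1+log₂a]≐2a : H ⊩ two ↑' S (log₂ a) ≐ two ·' a
  2^[1+log₂a]≐2a = lift (^-suc two (log₂ a)) ⟫ cong-* ≐-refl h

isPow2-* : H ⊩ isPow2 a → H ⊩ isPow2 b → H ⊩ isPow2 (a ·' b)
isPow2-* {H = H} {a = a} {b = b} ha hb =
  isPow2-intro 2^[log₂a+log₂b]≐ab (≤-respʳ-≐ (n≤2^n _) 2^[log₂a+log₂b]≐ab)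
  where
  2^[log₂a+log₂b]≐ab : H ⊩ two ↑' (log₂ a +' log₂ b) ≐ a ·' b
  2^[log₂a+log₂b]≐ab = lift (^-distribˡ-+-* two (log₂ a) (log₂ b)) ⟫ cong-* ha hb

isPow2-gap : H ⊩ isPow2 a → H ⊩ isPow2 b → H ⊩ log₂ a <' log₂ b → H ⊩ (two ·' a) ≤' b
isPow2-gap ha hb lt = ≤-respˡ-≐ (cong-* ≐-refl (≐-sym ha) ⟫ ≐-sym (lift (^-suc two _)))
                                (≤-respʳ-≐ (2^-mono-≤ (<⇒S≤ lt)) hb)

isPow2-unique : H ⊩ isPow2 a → H ⊩ isPow2 b →
                H ⊩ a ≤' c → H ⊩ c <' (two ·' a) → H ⊩ b ≤' c → H ⊩ c <' (two ·' b) → H ⊩ a ≐ b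
isPow2-unique {a = a} {b = b} ha hb a≤c c<2a b≤c c<2b = ∨-cases (lift (≤-total (log₂ a) (log₂ b)))
  (by-cases (≐-sym (weaken (weaken ha)) ⟫ cong-^ ≐-refl assumption ⟫ weaken (weaken hb))
            (apart (weaken (weaken ha)) (weaken (weaken hb)) (∧-intro (weaken assumption) assumption)
                   (weaken (weaken b≤c)) (weaken (weaken c<2a))))
  (by-cases (≐-sym (weaken (weaken ha)) ⟫ cong-^ ≐-refl (≐-sym assumption) ⟫ weaken (weaken hb))
            (apart (weaken (weaken hb)) (weaken (weaken ha)) (∧-intro (weaken assumption) assumption)
                   (weaken (weaken a≤c)) (weaken (weaken c<2b))))
  where
  apart : {G : Fm n} {p q : Tm n} → G ⊩ isPow2 p → G ⊩ isPow2 q → G ⊩ log₂ p <' log₂ q →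
          G ⊩ q ≤' c → G ⊩ c <' (two ·' p) → G ⊩ C
  apart hp hq lt q≤c c<2p = S[m]≤m-elim (≤-trans (<⇒S≤ c<2p) (≤-trans (isPow2-gap hp hq lt) q≤c))

-- The length function Q and the string part R

QB-isPow2 : H ⊩ QB ⟨ a , b ⟩ → H ⊩ isPow2 a
QB-isPow2 = ∧-elimˡ

QB-lower : H ⊩ QB ⟨ a , b ⟩ → H ⊩ a ≤' S b
QB-lower h = ∧-elimˡ (∧-elimʳ h)

QB-upper : H ⊩ QB ⟨ a , b ⟩ → H ⊩ S b <' (two ·' a)
QB-upper h = ∧-elimʳ (∧-elimʳ h)

QB-intro : H ⊩ isPow2 a → H ⊩ a ≤' S b → H ⊩ S b <' (two ·' a) → H ⊩ QB ⟨ a , b ⟩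
QB-intro h p q = ∧-intro h (∧-intro p q)

Q-witness : H ⊩ QB ⟨ a , b ⟩ → H ⊩ QB ⟨ Q' b , b ⟩
Q-witness h = μ-witness QB h (QB-lower h)

Q-unique : H ⊩ QB ⟨ a , b ⟩ → H ⊩ Q' b ≐ a
Q-unique h = isPow2-unique (QB-isPow2 (Q-witness h)) (QB-isPow2 h)
                           (QB-lower (Q-witness h)) (QB-upper (Q-witness h)) (QB-lower h) (QB-upper h)

QB-one : ⊢_ {n} (QB ⟨ S Z , Z ⟩)
QB-one = discharge (QB-intro (isPow2-intro (lift (^-zeroʳ two)) (lift (0∸n≐0 (S Z))))
                             (≤-refl (S Z))
                             (S≤⇒< (≤-respʳ-≐ (≤-refl two) (≐-sym (lift (*-identityʳ two))))))

QB-suc-same : H ⊩ QB ⟨ a , b ⟩ → H ⊩ S (S b) <' (two ·' a) → H ⊩ QB ⟨ a , S b ⟩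
QB-suc-same {b = b} h lt = QB-intro (QB-isPow2 h) (≤-trans (QB-lower h) (n≤S[n] (S b))) lt

QB-suc-double : H ⊩ QB ⟨ a , b ⟩ → H ⊩ S (S b) ≐ two ·' a → H ⊩ QB ⟨ two ·' a , S b ⟩
QB-suc-double h eq = QB-intro (isPow2-double (QB-isPow2 h)) (≤-respˡ-≐ (≐-sym eq) (≤-refl _))
  (S≤⇒< (≤-respˡ-≐ (cong-S eq ⟫ ≐-sym (lift (m+1≐S[m] _)))
                   (≤-respʳ-≐ (+-monoʳ-≤ _ (isPow2⇒1≤ (isPow2-double (QB-isPow2 h))))
                              (≐-sym (lift (2*n≐n+n _))))))

Q-correct : (a : Tm n) → ⊢ QB ⟨ Q' a , a ⟩
Q-correct a = inst (a ∷ []) Q-correctᵛ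
  where
  Q-correctᵛ : ⊢_ {1} (QB ⟨ Q' v0 , v0 ⟩)
  Q-correctᵛ = ind (discharge (Q-witness (lift QB-one)))
    (by-cases (Q-witness (QB-suc-same (weaken hypothesis) assumption))
              (Q-witness (QB-suc-double (weaken hypothesis)
                                        (≤∧¬<⇒≐ (<⇒S≤ (QB-upper (weaken hypothesis))) assumption))))

R+Q≐S : (a : Tm n) → ⊢ R' a +' Q' a ≐ S a
R+Q≐S a = discharge (lift (+-comm _ _) ⟫ m+[n∸m]≐n (QB-lower (lift (Q-correct a))))

S[R]≤Q : (a : Tm n) → ⊢ S (R' a) ≤' Q' a
S[R]≤Q a = discharge (+-cancelʳ-≤ (Q' a)
  (≤-respˡ-≐ (lift (+-sucˡ _ _) ⟫ cong-S (lift (R+Q≐S a)))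
             (≤-respʳ-≐ (<⇒S≤ (QB-upper (lift (Q-correct a)))) (lift (2*n≐n+n _)))))

-- Concatenation

S-⊕ : (a b : Tm n) → ⊢ S (a ⊕ b) ≐ (S a ·' Q' b) +' R' b
S-⊕ a b = discharge (≐-sym (1≤n⇒n≐S[P[n]] 1≤Sa·Qb+Rb))
  where
  1≤Sa·Qb+Rb : ⊤' ⊩ S Z ≤' ((S a ·' Q' b) +' R' b)
  1≤Sa·Qb+Rb = ≤-trans (isPow2⇒1≤ (QB-isPow2 (lift (Q-correct b))))
    (≤-trans (≤-respʳ-≐ (m≤m+n (Q' b) (a ·' Q' b)) (lift (+-comm _ _) ⟫ ≐-sym (lift (*-sucˡ a (Q' b)))))
             (m≤m+n (S a ·' Q' b) (R' b)))

QB-⊕ : (a b : Tm n) → ⊢ QB ⟨ Q' a ·' Q' b , a ⊕ b ⟩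
QB-⊕ a b = discharge (QB-intro (isPow2-* (QB-isPow2 (lift (Q-correct a))) (QB-isPow2 (lift (Q-correct b))))
                               lower upper)
  where
  lower : ⊤' ⊩ (Q' a ·' Q' b) ≤' S (a ⊕ b)
  lower = ≤-respʳ-≐ (≤-trans (*-monoˡ-≤ (Q' b) (QB-lower (lift (Q-correct a)))) (m≤m+n _ (R' b)))
                    (≐-sym (lift (S-⊕ a b)))
  upper : ⊤' ⊩ S (a ⊕ b) <' (two ·' (Q' a ·' Q' b))
  upper = S≤⇒< (≤-respˡ-≐ (cong-S (lift (S-⊕ a b)) ⟫ ≐-sym (lift (+-suc _ _)))
    (≤-trans (+-monoʳ-≤ _ (lift (S[R]≤Q b)))
      (≤-respˡ-≐ (≐-sym (lift (*-sucˡ (S a) _)))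
                 (≤-respʳ-≐ (*-monoˡ-≤ _ (<⇒S≤ (QB-upper (lift (Q-correct a))))) (lift (*-assoc _ _ _))))))

Q-⊕ : (a b : Tm n) → ⊢ Q' (a ⊕ b) ≐ Q' a ·' Q' b
Q-⊕ a b = discharge (Q-unique (lift (QB-⊕ a b)))

R-⊕ : (a b : Tm n) → ⊢ R' (a ⊕ b) ≐ (R' a ·' Q' b) +' R' b
R-⊕ a b = discharge (cong-∸ (lift (S-⊕ a b)) (lift (Q-⊕ a b))
  ⟫ cong-∸ (cong-+ (cong-* (≐-sym (lift (R+Q≐S a))) ≐-refl ⟫ lift (*-distribʳ-+ _ _ _)) ≐-refl
            ⟫ cong-+ (lift (+-comm _ _)) ≐-refl ⟫ lift (+-assoc _ _ _)) ≐-refl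
  ⟫ lift (m+n∸m≐n _ _))

⊕-assoc : (a b c : Tm n) → ⊢ a ⊕ (b ⊕ c) ≐ (a ⊕ b) ⊕ c
⊕-assoc a b c = discharge (S-injective (left ⟫ ≐-sym right))
  where
  left : ⊤' ⊩ S (a ⊕ (b ⊕ c)) ≐ (S a ·' (Q' b ·' Q' c)) +' ((R' b ·' Q' c) +' R' c)
  left = lift (S-⊕ a (b ⊕ c)) ⟫ cong-+ (cong-* ≐-refl (lift (Q-⊕ b c))) (lift (R-⊕ b c))
  right : ⊤' ⊩ S ((a ⊕ b) ⊕ c) ≐ (S a ·' (Q' b ·' Q' c)) +' ((R' b ·' Q' c) +' R' c)
  right = lift (S-⊕ (a ⊕ b) c) ⟫ cong-+ (cong-* (lift (S-⊕ a b)) ≐-refl ⟫ lift (*-distribʳ-+ _ _ _)) ≐-refl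
    ⟫ cong-+ (cong-+ (lift (*-assoc _ _ _)) ≐-refl) ≐-refl ⟫ lift (+-assoc _ _ _)

mainTheorem14 : ⊢_ {3} (var zero ⊕ (var (suc zero) ⊕ var (suc (suc zero))) ≐ (var zero ⊕ var (suc zero)) ⊕ var (suc (suc zero)))
mainTheorem14 = ⊕-assoc _ _ _
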